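{- Let $X$ and $Y$ be orthomodular lattices. Then (i) $\mathrm{Lin}(X,Y)$ is a join-semilattice with respect to the pointwise order inherited from $Y^X$; (ii) $\mathrm{Lin}(X)=\mathrm{Lin}(X,X)$ is an involutive unital m-semilattice with respect to the pointwise order, composition of maps as multiplication, the identity map as unit, and $f\mapsto f^*$ as involution.
   Context: Orthomodular lattice: a bounded lattice $X$ with a map $x\mapsto x^\perp$ such that $x^{\perp\perp}=x$, $x\le y\Rightarrow y^\perp\le x^\perp$, $x\wedge x^\perp=0$, and $x\le y$ implies $y=x\vee(x^\perp\wedge y)$. Write $x\perp y$ iff $x\le y^\perp$. A linear map $f\colon X\to Y$ is a function for which there exists $h\colon Y\to X$ (its adjoint, unique, denoted $f^*$) with $f(x)\perp y\iff x\perp h(y)$ for all $x,y$; $\mathrm{Lin}(X,Y)$ is the set of linear maps $X\to Y$. An m-semilattice is a join-semilattice $(S,\sqcup,0)$ with an associative multiplication distributing over finite joins on both sides ($x\cdot\bigsqcup_i x_i=\bigsqcup_i x\cdot x_i$, $(\bigsqcup_i x_i)\cdot x=\bigsqcup_i x_i\cdot x$ for finite index sets, including empty). It is unital if there is $e$ with $e\cdot a=a=a\cdot e$ for all $a$. It is involutive if it has a map ${}^*$ with $s^{**}=s$, $(s\cdot t)^*=t^*\cdot s^*$ and $(\bigsqcup_i x_i)^*=\bigsqcup_i x_i^*$ for finite families. -}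

module Defs where

open import Level using (Level; _⊔_; suc)
open import Relation.Binary.Core using (Rel)
open import Relation.Binary.PropositionalEquality using (_≡_; subst)
open import Relation.Binary.Lattice.Structures using (IsBoundedLattice; IsBoundedJoinSemilattice)
open import Function.Bundles using (_⇔_; mk⇔; Equivalence)
open import Function.Base using (_∘_; id)
import Function.Properties.Equivalence as EqP

record OrthomodularLattice (c ℓ : Level) : Set (suc (c ⊔ ℓ)) where
  infix 4 _≤_
  infixr 6 _∨_
  infixr 7 _∧_
  field
    Carrier : Set c
    _≤_     : Rel Carrier ℓ
    _∨_     : Carrier → Carrier → Carrier
    _∧_     : Carrier → Carrier → Carrier
    ⊤       : Carrier
    ⊥       : Carrier
    isBoundedLattice : IsBoundedLattice _≡_ _≤_ _∨_ _∧_ ⊤ ⊥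
    _ᗮ      : Carrier → Carrier
    ᗮ-invol : ∀ x → (x ᗮ) ᗮ ≡ x
    ᗮ-anti  : ∀ {x y} → x ≤ y → y ᗮ ≤ x ᗮ
    ᗮ-meet  : ∀ x → x ∧ (x ᗮ) ≡ ⊥
    orthomodular : ∀ {x y} → x ≤ y → y ≡ x ∨ ((x ᗮ) ∧ y)

  _⊥ₒ_ : Carrier → Carrier → Set ℓ
  x ⊥ₒ y = x ≤ y ᗮ

  ⊥ₒ-sym : ∀ {x y} → x ⊥ₒ y → y ⊥ₒ x
  ⊥ₒ-sym {x} {y} p = subst (λ z → z ≤ x ᗮ) (ᗮ-invol y) (ᗮ-anti p)

  ⊥ₒ-sym⇔ : ∀ {x y} → (x ⊥ₒ y) ⇔ (y ⊥ₒ x)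
  ⊥ₒ-sym⇔ = mk⇔ ⊥ₒ-sym ⊥ₒ-sym

open OrthomodularLattice

module _ {c₁ ℓ₁ c₂ ℓ₂ : Level} where

  -- The adjoint is unique (up to ≡ pointwise),
  -- so carrying it as data is the same as asserting its existence.
  record Lin (X : OrthomodularLattice c₁ ℓ₁) (Y : OrthomodularLattice c₂ ℓ₂)
           : Set (c₁ ⊔ ℓ₁ ⊔ c₂ ⊔ ℓ₂) where
    constructor mkLin
    field
      fun   : Carrier X → Carrier Y
      adj   : Carrier Y → Carrier X
      isAdj : ∀ x y → (_⊥ₒ_ Y (fun x) y) ⇔ (_⊥ₒ_ X x (adj y))

  open Lin public

  _≈ₚ_ : {X : OrthomodularLattice c₁ ℓ₁} {Y : OrthomodularLattice c₂ ℓ₂} →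
         Rel (Lin X Y) (c₁ ⊔ c₂)
  f ≈ₚ g = ∀ x → fun f x ≡ fun g x

  _≤ₚ_ : {X : OrthomodularLattice c₁ ℓ₁} {Y : OrthomodularLattice c₂ ℓ₂} →
         Rel (Lin X Y) (c₁ ⊔ ℓ₂)
  _≤ₚ_ {Y = Y} f g = ∀ x → _≤_ Y (fun f x) (fun g x)

module _ {c ℓ : Level} {X : OrthomodularLattice c ℓ} where

  _∘L_ : Lin X X → Lin X X → Lin X X
  f ∘L g = mkLin (fun f ∘ fun g) (adj g ∘ adj f)
    (λ x y → EqP.trans (isAdj f (fun g x) y) (isAdj g x (adj f y)))

  idL : Lin X X
  idL = mkLin id id (λ x y → EqP.refl)

  adjL : Lin X X → Lin X X
  adjL f = mkLin (adj f) (fun f)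
    (λ y x → EqP.trans (⊥ₒ-sym⇔ X)
               (EqP.trans (EqP.sym (isAdj f x y)) (⊥ₒ-sym⇔ X)))

-- Distributivity over finite joins is stated for the empty and the
-- binary join (which generate all finite joins).
record IsInvolutiveUnitalMSemilattice {a ℓ : Level} {S : Set a}
    (_≈_ : Rel S ℓ) (_⊔ₛ_ : S → S → S) (𝟘 : S)
    (_·_ : S → S → S) (e : S) (_⋆ : S → S) : Set (a ⊔ ℓ) where
  field
    ·-cong   : ∀ {x x′ y y′} → x ≈ x′ → y ≈ y′ → (x · y) ≈ (x′ · y′)
    ·-assoc  : ∀ x y z → ((x · y) · z) ≈ (x · (y · z))
    distribˡ : ∀ x y z → (x · (y ⊔ₛ z)) ≈ ((x · y) ⊔ₛ (x · z))
    distribʳ : ∀ x y z → ((y ⊔ₛ z) · x) ≈ ((y · x) ⊔ₛ (z · x))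
    zeroˡ    : ∀ x → (𝟘 · x) ≈ 𝟘
    zeroʳ    : ∀ x → (x · 𝟘) ≈ 𝟘
    identityˡ : ∀ x → (e · x) ≈ x
    identityʳ : ∀ x → (x · e) ≈ x
    ⋆-cong   : ∀ {x y} → x ≈ y → (x ⋆) ≈ (y ⋆)
    ⋆-invol  : ∀ x → ((x ⋆) ⋆) ≈ x
    ⋆-anti-· : ∀ x y → ((x · y) ⋆) ≈ ((y ⋆) · (x ⋆))
    ⋆-⊔      : ∀ x y → ((x ⊔ₛ y) ⋆) ≈ ((x ⋆) ⊔ₛ (y ⋆))
    ⋆-𝟘      : (𝟘 ⋆) ≈ 𝟘

{-# OPTIONS --safe #-}
module Submission where

-- Linear maps are residuated: f x ≤ z holds iff x ≤ (f* (zᗮ))ᗮ. Hence every linear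
-- map preserves finite joins, which is what makes composition distribute over joins
-- on the left (on the right it holds pointwise by definition). Since z ⊥ (a ∨ b) iff
-- z ⊥ a and z ⊥ b, the pointwise join of linear maps is linear with adjoint f* ∨ g*,
-- so Lin(X,Y) is a sub-join-semilattice of Y^X. An element is determined by the set
-- of elements orthogonal to it, so the adjoint depends only on the underlying
-- function, and the involution respects pointwise equality.

open import Defs
open import Level using (Level)
open import Algebra.Core using (Op₂)
open import Data.Product using (Σ; _×_; _,_)
open import Data.Product.Function.NonDependent.Propositional using (_×-⇔_)
open import Function.Base using (_on_)
open import Function.Bundles using (_⇔_; mk⇔; Equivalence)
open import Function.Related.Propositional using (equivalence; module EquationalReasoning)
import Function.Properties.Equivalence as ⇔
open import Relation.Binary.Core using (Rel)
open import Relation.Binary.Lattice.Structures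
  using (IsJoinSemilattice; IsBoundedJoinSemilattice; IsBoundedLattice)
open import Relation.Binary.PropositionalEquality using (_≡_; refl; cong; subst)
import Relation.Binary.PropositionalEquality as ≡
import Relation.Binary.Construct.On as On

module _ {a ℓ₁ ℓ₂} {A : Set a} {_≈_ : Rel A ℓ₁} {_≤_ : Rel A ℓ₂} {_∨_ : Op₂ A}
         (isJoinSemilattice : IsJoinSemilattice _≈_ _≤_ _∨_) where
  open IsJoinSemilattice isJoinSemilattice

  ∨-≤⇔ : ∀ {x y z} → (x ∨ y) ≤ z ⇔ (x ≤ z × y ≤ z)
  ∨-≤⇔ {x} {y} = mk⇔ (λ p → trans (x≤x∨y x y) p , trans (y≤x∨y x y) p)
                     (λ (p , q) → ∨-least p q)

module _ {a ℓ₁ ℓ₂} {A : Set a} {_≈_ : Rel A ℓ₁} {_≤_ : Rel A ℓ₂} {_∨_ : Op₂ A} {⊥ : A}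
         (isBJS : IsBoundedJoinSemilattice _≈_ _≤_ _∨_ ⊥) where
  open IsBoundedJoinSemilattice isBJS

  pointwise-isBoundedJoinSemilattice : ∀ {i} (I : Set i) →
    IsBoundedJoinSemilattice (λ f g → ∀ x → f x ≈ g x) (λ f g → ∀ x → f x ≤ g x)
                             (λ f g x → f x ∨ g x) (λ (_ : I) → ⊥)
  pointwise-isBoundedJoinSemilattice _ = record
    { isJoinSemilattice = record
      { isPartialOrder = record
        { isPreorder = record
          { isEquivalence = record
            { refl = λ _ → Eq.refl ; sym = λ p x → Eq.sym (p x) ; trans = λ p q x → Eq.trans (p x) (q x) }
          ; reflexive = λ p x → reflexive (p x)
          ; trans = λ p q x → trans (p x) (q x) }
        ; antisym = λ p q x → antisym (p x) (q x) }
      ; supremum = λ f g → (λ x → x≤x∨y (f x) (g x)) , (λ x → y≤x∨y (f x) (g x))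
                         , λ h p q x → ∨-least (p x) (q x) }
    ; minimum = λ f x → minimum (f x) }

module _ {a c ℓ₁ ℓ₂} {A : Set a} {_≈_ : Rel A ℓ₁} {_≤_ : Rel A ℓ₂} {_∨_ : Op₂ A} {⊥ : A}
         (isBJS : IsBoundedJoinSemilattice _≈_ _≤_ _∨_ ⊥)
         {C : Set c} {_⊔_ : Op₂ C} {𝟘 : C} (f : C → A) where
  open IsBoundedJoinSemilattice isBJS

  isBoundedJoinSemilattice-on : (∀ x y → f (x ⊔ y) ≈ (f x ∨ f y)) → f 𝟘 ≈ ⊥ →
    IsBoundedJoinSemilattice (_≈_ on f) (_≤_ on f) _⊔_ 𝟘
  isBoundedJoinSemilattice-on f-∨ f-⊥ = record
    { isJoinSemilattice = record
      { isPartialOrder = On.isPartialOrder f isPartialOrder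
      ; supremum = λ x y →
          ≤-respʳ-≈ (Eq.sym (f-∨ x y)) (x≤x∨y (f x) (f y))
        , ≤-respʳ-≈ (Eq.sym (f-∨ x y)) (y≤x∨y (f x) (f y))
        , λ z p q → ≤-respˡ-≈ (Eq.sym (f-∨ x y)) (∨-least p q) }
    ; minimum = λ x → ≤-respˡ-≈ (Eq.sym f-⊥) (minimum (f x)) }

module LeftAdjoint
    {a b ℓ₁ ℓ₂ ℓ₃ ℓ₄} {A : Set a} {B : Set b}
    {_≈ᴬ_ : Rel A ℓ₁} {_≤ᴬ_ : Rel A ℓ₂} {_∨ᴬ_ : Op₂ A} {⊥ᴬ : A}
    {_≈ᴮ_ : Rel B ℓ₃} {_≤ᴮ_ : Rel B ℓ₄} {_∨ᴮ_ : Op₂ B} {⊥ᴮ : B}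
    (isBJSᴬ : IsBoundedJoinSemilattice _≈ᴬ_ _≤ᴬ_ _∨ᴬ_ ⊥ᴬ)
    (isBJSᴮ : IsBoundedJoinSemilattice _≈ᴮ_ _≤ᴮ_ _∨ᴮ_ ⊥ᴮ)
    (f : A → B) (g : B → A) (f⊣g : ∀ {x z} → f x ≤ᴮ z ⇔ x ≤ᴬ g z) where
  private
    module A = IsBoundedJoinSemilattice isBJSᴬ
    module B = IsBoundedJoinSemilattice isBJSᴮ
  open Equivalence

  unit : ∀ x → x ≤ᴬ g (f x)
  unit x = to f⊣g B.refl

  preserves-∨ : ∀ x y → f (x ∨ᴬ y) ≈ᴮ (f x ∨ᴮ f y)
  preserves-∨ x y = B.antisym
    (from f⊣g (A.∨-least (to f⊣g (B.x≤x∨y _ _)) (to f⊣g (B.y≤x∨y _ _))))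
    (B.∨-least (from f⊣g (A.trans (A.x≤x∨y x y) (unit _)))
               (from f⊣g (A.trans (A.y≤x∨y x y) (unit _))))

  preserves-⊥ : f ⊥ᴬ ≈ᴮ ⊥ᴮ
  preserves-⊥ = B.antisym (from f⊣g (A.minimum _)) (B.minimum _)

module Orthogonality {c ℓ} (X : OrthomodularLattice c ℓ) where
  open OrthomodularLattice X
  open IsBoundedLattice isBoundedLattice
    using (isJoinSemilattice; minimum; antisym) renaming (refl to ≤-refl)
  open EquationalReasoning {k = equivalence}

  ≤⇔⊥ₒᗮ : ∀ {x y} → x ≤ y ⇔ x ⊥ₒ (y ᗮ)
  ≤⇔⊥ₒᗮ {x} {y} = subst (λ w → x ≤ y ⇔ x ≤ w) (≡.sym (ᗮ-invol y)) ⇔.refl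

  ⊥ₒ-∨⇔ : ∀ {x y z} → x ⊥ₒ (y ∨ z) ⇔ (x ⊥ₒ y × x ⊥ₒ z)
  ⊥ₒ-∨⇔ {x} {y} {z} =
    x ⊥ₒ (y ∨ z)        ∼⟨ ⊥ₒ-sym⇔ ⟩
    (y ∨ z) ⊥ₒ x        ∼⟨ ∨-≤⇔ isJoinSemilattice ⟩
    (y ⊥ₒ x × z ⊥ₒ x)   ∼⟨ ⊥ₒ-sym⇔ ×-⇔ ⊥ₒ-sym⇔ ⟩
    (x ⊥ₒ y × x ⊥ₒ z)   ∎

  ⊥-⊥ₒ : ∀ {x} → ⊥ ⊥ₒ x
  ⊥-⊥ₒ {x} = minimum (x ᗮ)

  ⊥ₒ-⊥ : ∀ {x} → x ⊥ₒ ⊥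
  ⊥ₒ-⊥ = ⊥ₒ-sym ⊥-⊥ₒ

  ⊥ₒ-⊆⇒≥ : ∀ {x y} → (∀ z → z ⊥ₒ x → z ⊥ₒ y) → y ≤ x
  ⊥ₒ-⊆⇒≥ {x} p = Equivalence.from ≤⇔⊥ₒᗮ (⊥ₒ-sym (p (x ᗮ) ≤-refl))

  ⊥ₒ-injective : ∀ {x y} → (∀ z → z ⊥ₒ x ⇔ z ⊥ₒ y) → x ≡ y
  ⊥ₒ-injective p = antisym (⊥ₒ-⊆⇒≥ (λ z → Equivalence.from (p z)))
                           (⊥ₒ-⊆⇒≥ (λ z → Equivalence.to (p z)))

module LinearMaps {c₁ ℓ₁ c₂ ℓ₂}
    (X : OrthomodularLattice c₁ ℓ₁) (Y : OrthomodularLattice c₂ ℓ₂) where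
  private
    module X = OrthomodularLattice X
    module Y = OrthomodularLattice Y
    module OX = Orthogonality X
    module OY = Orthogonality Y
    isBJSˣ = IsBoundedLattice.isBoundedJoinSemilattice X.isBoundedLattice
    isBJSʸ = IsBoundedLattice.isBoundedJoinSemilattice Y.isBoundedLattice
    isJSʸ = IsBoundedLattice.isJoinSemilattice Y.isBoundedLattice
  open X using (_⊥ₒ_)
  open Y using () renaming (_⊥ₒ_ to _⊥ʸ_)
  open EquationalReasoning {k = equivalence}

  residual : Lin X Y → Y.Carrier → X.Carrier
  residual f z = adj f (z Y.ᗮ) X.ᗮ

  residuated : ∀ f {x z} → fun f x Y.≤ z ⇔ x X.≤ residual f z
  residuated f {x} {z} = ⇔.trans OY.≤⇔⊥ₒᗮ (isAdj f x (z Y.ᗮ))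

  fun-∨ : ∀ f x y → fun f (x X.∨ y) ≡ fun f x Y.∨ fun f y
  fun-∨ f = LeftAdjoint.preserves-∨ isBJSˣ isBJSʸ (fun f) (residual f) (residuated f)

  fun-⊥ : ∀ f → fun f X.⊥ ≡ Y.⊥
  fun-⊥ f = LeftAdjoint.preserves-⊥ isBJSˣ isBJSʸ (fun f) (residual f) (residuated f)

  adj-cong : ∀ {f g : Lin X Y} → f ≈ₚ g → ∀ y → adj f y ≡ adj g y
  adj-cong {f} {g} f≈g y = OX.⊥ₒ-injective λ z →
    z ⊥ₒ adj f y   ∼⟨ ⇔.sym (isAdj f z y) ⟩
    fun f z ⊥ʸ y   ≡⟨ cong (_⊥ʸ y) (f≈g z) ⟩
    fun g z ⊥ʸ y   ∼⟨ isAdj g z y ⟩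
    z ⊥ₒ adj g y   ∎

  _⊔L_ : Lin X Y → Lin X Y → Lin X Y
  f ⊔L g = mkLin (λ x → fun f x Y.∨ fun g x) (λ y → adj f y X.∨ adj g y) λ x y →
    (fun f x Y.∨ fun g x) ⊥ʸ y      ∼⟨ ∨-≤⇔ isJSʸ ⟩
    (fun f x ⊥ʸ y × fun g x ⊥ʸ y)   ∼⟨ isAdj f x y ×-⇔ isAdj g x y ⟩
    (x ⊥ₒ adj f y × x ⊥ₒ adj g y)   ∼⟨ ⇔.sym OX.⊥ₒ-∨⇔ ⟩
    x ⊥ₒ (adj f y X.∨ adj g y)      ∎

  𝟘L : Lin X Y
  𝟘L = mkLin (λ _ → Y.⊥) (λ _ → X.⊥) λ _ _ → mk⇔ (λ _ → OX.⊥ₒ-⊥) (λ _ → OY.⊥-⊥ₒ)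

  ⊔L-isBoundedJoinSemilattice : IsBoundedJoinSemilattice _≈ₚ_ _≤ₚ_ _⊔L_ 𝟘L
  ⊔L-isBoundedJoinSemilattice = isBoundedJoinSemilattice-on
    (pointwise-isBoundedJoinSemilattice isBJSʸ X.Carrier) fun (λ _ _ _ → refl) (λ _ → refl)

module LinearEndomaps {c ℓ} (X : OrthomodularLattice c ℓ) where
  open LinearMaps X X

  isInvolutiveUnitalMSemilattice :
    IsInvolutiveUnitalMSemilattice _≈ₚ_ _⊔L_ 𝟘L _∘L_ idL adjL
  isInvolutiveUnitalMSemilattice = record
    { ·-cong    = λ {f} {_} {_} {g′} f≈f′ g≈g′ x →
                    ≡.trans (cong (fun f) (g≈g′ x)) (f≈f′ (fun g′ x))
    ; ·-assoc   = λ _ _ _ _ → refl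
    ; distribˡ  = λ f g h x → fun-∨ f (fun g x) (fun h x)
    ; distribʳ  = λ _ _ _ _ → refl
    ; zeroˡ     = λ _ _ → refl
    ; zeroʳ     = λ f _ → fun-⊥ f
    ; identityˡ = λ _ _ → refl
    ; identityʳ = λ _ _ → refl
    ; ⋆-cong    = λ {f} {g} → adj-cong {f} {g}
    ; ⋆-invol   = λ _ _ → refl
    ; ⋆-anti-·  = λ _ _ _ → refl
    ; ⋆-⊔       = λ _ _ _ → refl
    ; ⋆-𝟘       = λ _ → refl
    }

mainTheorem8 : {c₁ ℓ₁ c₂ ℓ₂ : Level}
    (X : OrthomodularLattice c₁ ℓ₁) (Y : OrthomodularLattice c₂ ℓ₂) →
    -- (i) Lin(X,Y) is a join-semilattice (with 0) for the pointwise order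
    (Σ (Lin X Y → Lin X Y → Lin X Y) λ _⊔_ → Σ (Lin X Y) λ 𝟘 →
      IsBoundedJoinSemilattice (_≈ₚ_ {X = X} {Y = Y}) _≤ₚ_ _⊔_ 𝟘)
    ×
    -- (ii) Lin(X) is an involutive unital m-semilattice
    (Σ (Lin X X → Lin X X → Lin X X) λ _⊔_ → Σ (Lin X X) λ 𝟘 →
      IsBoundedJoinSemilattice (_≈ₚ_ {X = X} {Y = X}) _≤ₚ_ _⊔_ 𝟘
      × IsInvolutiveUnitalMSemilattice (_≈ₚ_ {X = X} {Y = X}) _⊔_ 𝟘
          _∘L_ idL adjL)
mainTheorem8 X Y =
  (_⊔L_ X Y , 𝟘L X Y , ⊔L-isBoundedJoinSemilattice X Y) ,
  (_⊔L_ X X , 𝟘L X X , ⊔L-isBoundedJoinSemilattice X X ,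
   LinearEndomaps.isInvolutiveUnitalMSemilattice X)
  where open LinearMaps
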